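{- In the generalized Zeckendorf game with $p=3$ players on any $n\ge 5$, player $2$ does not have a winning strategy.
   Context: Let $a_1=1$, $a_2=2$ and $a_{i+1}=i\,a_i+a_{i-1}$ for $i\ge 2$. The generalized Zeckendorf game on $n$: the state is a multiset of terms of the sequence, initially $n$ copies of $a_1=1$. A move is one of: (combining) replace two $1$'s by one $2$; or, for $i\ge 2$, if the multiset contains at least $i$ copies of $a_i$ and at least one $a_{i-1}$, replace $i$ copies of $a_i$ and one $a_{i-1}$ by one $a_{i+1}$; (splitting) if it contains three $2$'s, replace them by one $1$ and one $5$; or, for $i\ge 3$, if it contains $i+1$ copies of $a_i$, replace them by one $a_{i+1}$, $i-2$ copies of $a_{i-1}$ and one $a_{i-2}$. Players $1,2,3$ move in cyclic order (player 1 first) until no move is available; the player making the last move wins. A player has a winning strategy if that player can guarantee making the last move regardless of the moves of the other players. -}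

module Defs where

open import Data.Nat using (ℕ; zero; suc; _+_; _∸_; _≤_; _≡ᵇ_)
open import Data.Bool using (if_then_else_)
open import Data.Fin using (Fin; zero; suc)
open import Data.Product using (Σ)
open import Relation.Binary.PropositionalEquality using (_≡_; _≢_)
open import Relation.Nullary using (¬_)

-- A game state is a multiset of terms of the sequence a_1 = 1, a_2 = 2,
-- a_{i+1} = i a_i + a_{i-1}, represented by its multiplicity function:
-- s i = number of copies of a_i (index 0 is unused and stays 0).
State : Set
State = ℕ → ℕ

[_==_]_ : ℕ → ℕ → ℕ → ℕ
[ j == k ] x = if j ≡ᵇ k then x else 0

init : ℕ → State
init n j = [ j == 1 ] n

data Step (s t : State) : Set where
  combine1 : 2 ≤ s 1 →
    (∀ j → t j ≡ (s j ∸ [ j == 1 ] 2) + [ j == 2 ] 1) → Step s t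
  combine : ∀ i → 2 ≤ i → i ≤ s i → 1 ≤ s (i ∸ 1) →
    (∀ j → t j ≡ ((s j ∸ [ j == i ] i) ∸ [ j == i ∸ 1 ] 1) + [ j == suc i ] 1) →
    Step s t
  -- three 2's -> one 1 and one 5 (= a_3)
  split2 : 3 ≤ s 2 →
    (∀ j → t j ≡ ((s j ∸ [ j == 2 ] 3) + [ j == 1 ] 1) + [ j == 3 ] 1) → Step s t
  split : ∀ i → 3 ≤ i → suc i ≤ s i →
    (∀ j → t j ≡ (((s j ∸ [ j == i ] suc i) + [ j == suc i ] 1)
                   + [ j == i ∸ 1 ] (i ∸ 2)) + [ j == i ∸ 2 ] 1) →
    Step s t

Terminal : State → Set
Terminal s = ∀ t → ¬ Step s t

-- Players 1, 2, 3 are zero, suc zero, suc (suc zero) in Fin 3.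
Player : Set
Player = Fin 3

next : Player → Player
next zero = suc zero
next (suc zero) = suc (suc zero)
next (suc (suc zero)) = zero

-- Wins p q s : with player q to move in state s, player p can guarantee
-- making the last move, regardless of the moves of the other players.
data Wins (p : Player) : Player → State → Set where
  -- game over, and the last move was made by p (the player before q)
  done   : ∀ {q s} → Terminal s → q ≡ next p → Wins p q s
  mine   : ∀ {s} t → Step s t → Wins p (next p) t → Wins p p s
  others : ∀ {q s} → q ≢ p → Σ State (Step s) →
           (∀ t → Step s t → Wins p (next q) t) → Wins p q s

HasWinningStrategy : Player → ℕ → Set
HasWinningStrategy p n = Wins p zero (init n)

{-# OPTIONS --safe #-}
-- Player 1's only move combines two 1's, and then so does player 2's, leaving
-- n − 4 ones and two 2's for player 3.  For n = 5, player 3 combines 1 + 2 + 2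
-- into a 5 and the game is over.  For n > 5, player 3 can reach the position
-- "n − 5 ones and one 5" either with player 1 to move (combine 1 + 2 + 2) or,
-- after combining two 1's and letting player 1 split the three 2's, with
-- player 2 to move.  A winning strategy for player 2 would have to win this
-- position with both movers, but a position is won for a fixed player with at
-- most one player to move: the opponents can copy each other's (or the
-- winner's) moves until the game ends, and the end fixes who was to move.
module Submission where

open import Defs
open import Data.Nat using (ℕ; _≤_; zero; suc; _+_; _∸_; z≤n; s≤s)
open import Data.Nat.Properties using (+-identityʳ; +-comm; m≤n⇒∃[o]m+o≡n)
open import Data.Fin using (zero; suc)
open import Data.Fin.Properties using (0≢1+n)
open import Data.Product using (_,_)
open import Data.Empty using (⊥-elim)
open import Function using (_∘_)
open import Relation.Nullary using (¬_)
open import Relation.Binary.PropositionalEquality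
  using (_≡_; _≢_; _≗_; refl; sym; trans; cong; subst)

next-injective : ∀ {p q} → next p ≡ next q → p ≡ q
next-injective {zero} {zero} _ = refl
next-injective {suc zero} {suc zero} _ = refl
next-injective {suc (suc zero)} {suc (suc zero)} _ = refl
next-injective {zero} {suc zero} ()
next-injective {zero} {suc (suc zero)} ()
next-injective {suc zero} {zero} ()
next-injective {suc zero} {suc (suc zero)} ()
next-injective {suc (suc zero)} {zero} ()
next-injective {suc (suc zero)} {suc zero} ()

p≢next-p : ∀ p → p ≢ next p
p≢next-p zero = λ ()
p≢next-p (suc zero) = λ ()
p≢next-p (suc (suc zero)) = λ ()

module _ {s s′ : State} (s≗s′ : s ≗ s′) where

  private
    along : ∀ {t : State} (F : ℕ → ℕ → ℕ) →
            (∀ j → t j ≡ F j (s j)) → ∀ j → t j ≡ F j (s′ j)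
    along F eq j = trans (eq j) (cong (F j) (s≗s′ j))

  Step-respˡ : ∀ {t} → Step s t → Step s′ t
  Step-respˡ (combine1 le eq) =
    combine1 (subst (2 ≤_) (s≗s′ 1) le)
      (along (λ j v → (v ∸ [ j == 1 ] 2) + [ j == 2 ] 1) eq)
  Step-respˡ (combine i 2≤i le₁ le₂ eq) =
    combine i 2≤i (subst (i ≤_) (s≗s′ i) le₁) (subst (1 ≤_) (s≗s′ (i ∸ 1)) le₂)
      (along (λ j v → ((v ∸ [ j == i ] i) ∸ [ j == i ∸ 1 ] 1) + [ j == suc i ] 1) eq)
  Step-respˡ (split2 le eq) =
    split2 (subst (3 ≤_) (s≗s′ 2) le)
      (along (λ j v → ((v ∸ [ j == 2 ] 3) + [ j == 1 ] 1) + [ j == 3 ] 1) eq)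
  Step-respˡ (split i 3≤i le eq) =
    split i 3≤i (subst (suc i ≤_) (s≗s′ i) le)
      (along (λ j v → (((v ∸ [ j == i ] suc i) + [ j == suc i ] 1)
                        + [ j == i ∸ 1 ] (i ∸ 2)) + [ j == i ∸ 2 ] 1) eq)

≗-sym : {s s′ : State} → s ≗ s′ → s′ ≗ s
≗-sym s≗s′ j = sym (s≗s′ j)

≗-trans : {s s′ s″ : State} → s ≗ s′ → s′ ≗ s″ → s ≗ s″
≗-trans s≗s′ s′≗s″ j = trans (s≗s′ j) (s′≗s″ j)

Terminal-resp : {s s′ : State} → s ≗ s′ → Terminal s → Terminal s′
Terminal-resp s≗s′ term t step = term t (Step-respˡ (≗-sym s≗s′) step)

Wins-resp : ∀ {p q} {s s′ : State} → s ≗ s′ → Wins p q s → Wins p q s′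
Wins-resp s≗s′ (done term q≡) = done (Terminal-resp s≗s′ term) q≡
Wins-resp s≗s′ (mine t step w) = mine t (Step-respˡ s≗s′ step) w
Wins-resp s≗s′ (others q≢p (v , step) f) =
  others q≢p (v , Step-respˡ s≗s′ step) λ t step′ → f t (Step-respˡ (≗-sym s≗s′) step′)

Wins-terminal : ∀ {p q s} → Terminal s → Wins p q s → q ≡ next p
Wins-terminal _ (done _ q≡) = q≡
Wins-terminal term (mine t step _) = ⊥-elim (term t step)
Wins-terminal term (others _ (v , step) _) = ⊥-elim (term v step)

Wins-opponent-move : ∀ {p q s t} → q ≢ p → Wins p q s → Step s t → Wins p (next q) t
Wins-opponent-move _ (done term _) step = ⊥-elim (term _ step)
Wins-opponent-move q≢p (mine _ _ _) _ = ⊥-elim (q≢p refl)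
Wins-opponent-move _ (others _ _ f) step = f _ step

Wins-forced-move : ∀ {p s s′} → (∀ t → Step s t → t ≗ s′) → Wins p p s → Wins p (next p) s′
Wins-forced-move {p} _ (done _ p≡) = ⊥-elim (p≢next-p p p≡)
Wins-forced-move only (mine t step w) = Wins-resp (only t step) w
Wins-forced-move _ (others p≢p _ _) = ⊥-elim (p≢p refl)

Wins-mover-unique : ∀ {p q q′ s} → Wins p q s → Wins p q′ s → q ≡ q′
Wins-mover-unique (done _ q≡) (done _ q′≡) = trans q≡ (sym q′≡)
Wins-mover-unique (done term _) (mine t step _) = ⊥-elim (term t step)
Wins-mover-unique (done term _) (others _ (v , step) _) = ⊥-elim (term v step)
Wins-mover-unique (mine t step _) (done term _) = ⊥-elim (term t step)
Wins-mover-unique (mine _ _ _) (mine _ _ _) = refl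
Wins-mover-unique (mine t step w) (others _ _ g) = next-injective (Wins-mover-unique w (g t step))
Wins-mover-unique (others _ (v , step) _) (done term _) = ⊥-elim (term v step)
Wins-mover-unique (others _ _ f) (mine t step w) = next-injective (Wins-mover-unique (f t step) w)
Wins-mover-unique (others _ (v , step) f) (others _ _ g) =
  next-injective (Wins-mover-unique (f v step) (g v step))

position : ℕ → ℕ → ℕ → State
position x y z 1 = x
position x y z 2 = y
position x y z 3 = z
position x y z _ = 0

position-≗ : ∀ {x y z} {F : ℕ → ℕ} → 0 ≡ F 0 → x ≡ F 1 → y ≡ F 2 → z ≡ F 3 →
             (∀ j → 0 ≡ F (4 + j)) → position x y z ≗ F
position-≗ e₀ _ _ _ _ 0 = e₀
position-≗ _ e₁ _ _ _ 1 = e₁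
position-≗ _ _ e₂ _ _ 2 = e₂
position-≗ _ _ _ e₃ _ 3 = e₃
position-≗ _ _ _ _ e₄ (suc (suc (suc (suc j)))) = e₄ j

init-≗-position : ∀ n → init n ≗ position n 0 0
init-≗-position n = ≗-sym (position-≗ refl refl refl refl λ _ → refl)

combine-ones : ∀ x y z → Step (position (2 + x) y z) (position x (suc y) z)
combine-ones x y z = combine1 (s≤s (s≤s z≤n))
  (position-≗ refl (sym (+-identityʳ x)) (sym (+-comm y 1)) (sym (+-identityʳ z)) λ _ → refl)

combine-twos : ∀ x y z → Step (position (suc x) (2 + y) z) (position x y (suc z))
combine-twos x y z = combine 2 (s≤s (s≤s z≤n)) (s≤s (s≤s z≤n)) (s≤s z≤n)
  (position-≗ refl (sym (+-identityʳ x)) (sym (+-identityʳ y)) (sym (+-comm z 1)) λ _ → refl)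

split-twos : ∀ x y z → Step (position x (3 + y) z) (position (suc x) y (suc z))
split-twos x y z = split2 (s≤s (s≤s (s≤s z≤n)))
  (position-≗ refl (sym (trans (+-identityʳ (x + 1)) (+-comm x 1)))
    (sym (trans (+-identityʳ (y + 0)) (+-identityʳ y)))
    (sym (trans (cong (_+ 1) (+-identityʳ z)) (+-comm z 1))) λ _ → refl)

only-move-combines-ones : ∀ x t → Step (position (2 + x) 1 0) t → t ≗ position x 2 0
only-move-combines-ones x t (combine1 _ eq) =
  ≗-trans eq (≗-sym (position-≗ refl (sym (+-identityʳ x)) refl refl λ _ → refl))
only-move-combines-ones x t (combine (suc (suc zero)) _ (s≤s ()) _ _)
only-move-combines-ones x t (combine (suc (suc (suc zero))) _ () _ _)
only-move-combines-ones x t (combine (suc (suc (suc (suc i)))) _ () _ _)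
only-move-combines-ones x t (split2 (s≤s ()) _)
only-move-combines-ones x t (split (suc zero) (s≤s ()) _ _)
only-move-combines-ones x t (split (suc (suc zero)) (s≤s (s≤s ())) _ _)
only-move-combines-ones x t (split (suc (suc (suc zero))) _ () _)
only-move-combines-ones x t (split (suc (suc (suc (suc i)))) _ () _)

single-five-terminal : Terminal (position 0 0 1)
single-five-terminal t (combine1 () _)
single-five-terminal t (combine (suc (suc zero)) _ () _ _)
single-five-terminal t (combine (suc (suc (suc zero))) _ (s≤s ()) _ _)
single-five-terminal t (combine (suc (suc (suc (suc i)))) _ () _ _)
single-five-terminal t (split2 () _)
single-five-terminal t (split (suc zero) (s≤s ()) _ _)
single-five-terminal t (split (suc (suc zero)) (s≤s (s≤s ())) _ _)
single-five-terminal t (split (suc (suc (suc zero))) _ (s≤s ()) _)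
single-five-terminal t (split (suc (suc (suc (suc i)))) _ () _)

player₂ : Player
player₂ = suc zero

player₃-prevents-win : ∀ m → ¬ Wins player₂ (suc (suc zero)) (position (suc m) 2 0)
player₃-prevents-win zero w = 0≢1+n (Wins-terminal single-five-terminal
  (Wins-opponent-move (λ ()) w (combine-twos 0 0 0)))
player₃-prevents-win (suc k) w = 0≢1+n (Wins-mover-unique player₁-to-move player₂-to-move)
  where
  player₁-to-move : Wins player₂ zero (position (suc k) 0 1)
  player₁-to-move = Wins-opponent-move (λ ()) w (combine-twos (suc k) 0 0)
  player₂-to-move : Wins player₂ player₂ (position (suc k) 0 1)
  player₂-to-move = Wins-opponent-move (λ ())
    (Wins-opponent-move (λ ()) w (combine-ones k 2 0)) (split-twos k 0 0)

theorem7p2 : (n : ℕ) → 5 ≤ n → ¬ HasWinningStrategy (suc zero) n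
theorem7p2 n 5≤n with m≤n⇒∃[o]m+o≡n 5≤n
... | m , refl = player₃-prevents-win m ∘ after-opening
  where
  after-opening : HasWinningStrategy player₂ (5 + m) →
                  Wins player₂ (suc (suc zero)) (position (suc m) 2 0)
  after-opening w = Wins-forced-move (only-move-combines-ones (suc m))
    (Wins-opponent-move (λ ()) (Wins-resp (init-≗-position (5 + m)) w) (combine-ones (3 + m) 0 0))
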